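{- Let $w$ be an infinite word such that $\mathcal{P}_n(w)=1$ for every even $n\ge 0$ and $\mathcal{P}_n(w)=2$ for every odd $n\ge 0$. Then $w$ is aperiodic (not ultimately periodic).
   Context: $\mathcal{P}_n(w)$ is the number of distinct palindromic factors of $w$ of length $n$ (the empty word is a palindrome). An infinite word is ultimately periodic if it equals $uv^\omega$ for finite words $u,v$ with $v$ nonempty, and aperiodic otherwise. -}

module Defs where

open import Data.Nat using (ℕ; zero; suc; _+_; _∸_; _<_; _%_; NonZero)
open import Data.List using (List; []; _∷_; length; reverse; lookup)
open import Data.List.Membership.Propositional using (_∈_)
open import Data.List.Relation.Unary.Unique.Propositional using (Unique)
open import Data.Fin using (fromℕ<)
open import Data.Nat.DivMod using (m%n<n)
open import Data.Product using (Σ; ∃; _×_; _,_)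
open import Relation.Binary.PropositionalEquality using (_≡_)
open import Relation.Nullary using (¬_)

Word : Set → Set
Word A = ℕ → A

factorAt : {A : Set} → Word A → ℕ → ℕ → List A
factorAt w i zero    = []
factorAt w i (suc n) = w i ∷ factorAt w (suc i) n

IsFactor : {A : Set} → Word A → ℕ → List A → Set
IsFactor w n u = ∃ λ i → factorAt w i n ≡ u

IsPalindrome : {A : Set} → List A → Set
IsPalindrome u = reverse u ≡ u

PalFactor : {A : Set} → Word A → ℕ → List A → Set
PalFactor w n u = IsFactor w n u × IsPalindrome u

-- 𝒫ₙ(w) = k : the set of palindromic factors of w of length n has exactly k
-- elements, i.e. it is enumerated by a duplicate-free list of length k.
PalCount : {A : Set} → Word A → ℕ → ℕ → Set
PalCount {A} w n k =
  Σ (List (List A)) λ ps → Unique ps × length ps ≡ k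
    × (∀ u → PalFactor w n u → u ∈ ps)
    × (∀ u → u ∈ ps → PalFactor w n u)

-- the infinite word u v^ω, for nonempty v = x ∷ xs
uvω : {A : Set} (u : List A) (x : A) (xs : List A) → Word A
uvω []       x xs i = lookup (x ∷ xs) (fromℕ< (m%n<n i (suc (length xs))))
uvω (c ∷ cs) x xs zero    = c
uvω (c ∷ cs) x xs (suc i) = uvω cs x xs i

UltimatelyPeriodic : {A : Set} → Word A → Set
UltimatelyPeriodic {A} w =
  Σ (List A) λ u → Σ A λ x → Σ (List A) λ xs → ∀ i → w i ≡ uvω u x xs i

Aperiodic : {A : Set} → Word A → Set
Aperiodic w = ¬ UltimatelyPeriodic w

module Submission where

-- Suppose w = u v^ω.  The suffix f of w after u has a period, and by strong
-- induction on the period we may assume it has least period p.  In a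
-- p-periodic word a palindrome of length ≥ p with centre c/2 makes f
-- symmetric: f a ≡ f b whenever a + b ≡ c (mod p); two symmetries with
-- centres c, c' make c' − c a period, so by minimality all centres are
-- congruent mod p.  Palindromes of length 2K and 2K + 1, K = |u| + p, contain
-- such palindromes of f in their middle.  For even p the even palindrome has
-- an odd c and the odd ones an even c: impossible.  For odd p the two odd
-- palindromes start at positions i₁ ≡ i₂ (mod p), so they agree beyond |u|,
-- hence (being palindromes) everywhere: impossible, as they are distinct.

open import Defs
open import Data.Nat using (ℕ; _*_; _+_)

open import Data.Nat using (suc; zero; _∸_; _≤_; _<_; _%_; s≤s; z≤n; _≤?_)
open import Data.Nat.Properties
  using (+-identityʳ; +-suc; +-comm; m+n∸m≡n; m+[n∸m]≡n; m≤m+n; ≤-trans; ≤-pred;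
         +-cancelˡ-≤; +-monoˡ-≤; ≰⇒>; ≤-reflexive; n≤1+n; 1+n≢0)
open import Data.Nat.DivMod
  using (m≡m%n+[m/n]*n; m%n%n≡m%n; [m+kn]%n≡m%n; %-distribˡ-+; %-distribˡ-*;
         m%n<n; m∣n⇒o%n%m≡o%m; [m+n]%n≡m%n; _/_)
open import Data.Nat.Divisibility using (_∣_; divides)
open import Data.Nat.Induction using (<-rec)
open import Data.Nat.Tactic.RingSolver using (solve-∀)
open import Data.List using (List; []; _∷_; _∷ʳ_; reverse; length; lookup)
open import Data.List.Properties using (∷-injectiveˡ; ∷-injectiveʳ; reverse-++)
open import Data.List.Relation.Unary.Any using (here; there)
open import Data.List.Relation.Unary.All using ([]; _∷_)
open import Data.List.Relation.Unary.AllPairs using (_∷_)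
open import Data.Fin.Properties using (fromℕ<-cong)
open import Data.Product using (Σ; ∃; _×_; _,_)
open import Data.Sum using (_⊎_; inj₁; inj₂)
open import Data.Empty using (⊥; ⊥-elim)
open import Relation.Nullary using (¬_; yes; no)
open import Level using (0ℓ)
open import Relation.Binary using (Setoid; IsEquivalence)
import Relation.Binary.Reasoning.Setoid as SetoidReasoning
open import Relation.Binary.PropositionalEquality
  using (_≡_; _≢_; refl; sym; trans; cong; cong₂; module ≡-Reasoning)

factorAt-cong : {A : Set} (g h : Word A) (i j n : ℕ) →
  (∀ s → s < n → g (i + s) ≡ h (j + s)) → factorAt g i n ≡ factorAt h j n
factorAt-cong g h i j zero agree = refl
factorAt-cong g h i j (suc n) agree =
  cong₂ _∷_ (first (agree 0 (s≤s z≤n)))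
         (factorAt-cong g h (suc i) (suc j) n λ s s<n →
            trans (cong g (sym (+-suc i s)))
                  (trans (agree (suc s) (s≤s s<n)) (cong h (+-suc j s))))
  where
  first : g (i + 0) ≡ h (j + 0) → g i ≡ h j
  first e = trans (cong g (sym (+-identityʳ i))) (trans e (cong h (+-identityʳ j)))

factorAt-pointwise : {A : Set} (g h : Word A) (i j n : ℕ) →
  factorAt g i n ≡ factorAt h j n → ∀ s → s < n → g (i + s) ≡ h (j + s)
factorAt-pointwise g h i j (suc n) eq zero _ =
  trans (cong g (+-identityʳ i)) (trans (∷-injectiveˡ eq) (cong h (sym (+-identityʳ j))))
factorAt-pointwise g h i j (suc n) eq (suc s) (s≤s s<n) =
  trans (cong g (+-suc i s))
        (trans (factorAt-pointwise g h (suc i) (suc j) n (∷-injectiveʳ eq) s s<n)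
               (cong h (sym (+-suc j s))))

factorAt-snoc : {A : Set} (g : Word A) (i n : ℕ) →
  factorAt g i (suc n) ≡ factorAt g i n ∷ʳ g (i + n)
factorAt-snoc g i zero = cong (λ k → g k ∷ []) (sym (+-identityʳ i))
factorAt-snoc g i (suc n) = cong (g i ∷_)
  (trans (factorAt-snoc g (suc i) n) (cong (λ k → factorAt g (suc i) n ∷ʳ g k) (sym (+-suc i n))))

reverse-factorAt : {A : Set} (g : Word A) (i n : ℕ) →
  reverse (factorAt g i n) ≡ factorAt (λ s → g (i + (n ∸ suc s))) 0 n
reverse-factorAt g i zero = refl
reverse-factorAt {A} g i (suc n) = begin
  reverse (factorAt g i (suc n))          ≡⟨ cong reverse (factorAt-snoc g i n) ⟩
  reverse (factorAt g i n ∷ʳ g (i + n))   ≡⟨ reverse-++ (factorAt g i n) (g (i + n) ∷ []) ⟩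
  g (i + n) ∷ reverse (factorAt g i n)    ≡⟨ cong (g (i + n) ∷_) (reverse-factorAt g i n) ⟩
  g (i + n) ∷ factorAt backwards 0 n      ≡⟨ cong (g (i + n) ∷_) shift ⟩
  factorAt backwards′ 0 (suc n)           ∎
  where
  open ≡-Reasoning
  backwards backwards′ : Word A
  backwards  s = g (i + (n ∸ suc s))
  backwards′ s = g (i + (suc n ∸ suc s))
  shift : factorAt backwards 0 n ≡ factorAt backwards′ 1 n
  shift = factorAt-cong backwards backwards′ 0 1 n λ _ _ → refl

PalindromeAt : {A : Set} → Word A → ℕ → ℕ → Set
PalindromeAt g i L = ∀ s t → suc (s + t) ≡ L → g (i + s) ≡ g (i + t)

palindrome⇒PalindromeAt : {A : Set} (g : Word A) (i L : ℕ) →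
  IsPalindrome (factorAt g i L) → PalindromeAt g i L
palindrome⇒PalindromeAt {A} g i L pal s t refl =
  trans (factorAt-pointwise g backwards i 0 L mirrored s (s≤s (m≤m+n s t)))
        (cong (λ k → g (i + k)) (m+n∸m≡n s t))
  where
  backwards : Word A
  backwards s = g (i + (L ∸ suc s))
  mirrored : factorAt g i L ≡ factorAt backwards 0 L
  mirrored = trans (sym pal) (reverse-factorAt g i L)

suffix : {A : Set} → ℕ → Word A → Word A
suffix N g j = g (N + j)

trim : {A : Set} (g : Word A) (N i M L : ℕ) → N + M + N ≡ L →
  PalindromeAt g i L → PalindromeAt (suffix N g) i M
trim g N i M L refl pal s t refl =
  trans (cong g (reassoc N i s)) (trans (pal (N + s) (t + N) (length-eq N s t))
        (cong g (sym (reassoc′ N i t))))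
  where
  reassoc : ∀ N i s → N + (i + s) ≡ i + (N + s)
  reassoc = solve-∀
  reassoc′ : ∀ N i t → N + (i + t) ≡ i + (t + N)
  reassoc′ = solve-∀
  length-eq : ∀ N s t → suc (N + s + (t + N)) ≡ N + suc (s + t) + N
  length-eq = solve-∀

-- Two palindromes of length L which agree from offset N on, where 2N ≤ L,
-- are equal: each letter before offset N mirrors a letter beyond it.
palindromes-equal : {A : Set} (g : Word A) (i j N L : ℕ) →
  PalindromeAt g i L → PalindromeAt g j L → N + N ≤ L →
  (∀ t → N ≤ t → g (i + t) ≡ g (j + t)) → factorAt g i L ≡ factorAt g j L
palindromes-equal g i j N L palᵢ palⱼ 2N≤L agree = factorAt-cong g g i j L letter
  where
  letter : ∀ t → t < L → g (i + t) ≡ g (j + t)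
  letter t t<L with N ≤? t
  ... | yes N≤t = agree t N≤t
  ... | no  N≰t = trans (palᵢ t t′ mirror) (trans (agree t′ N≤t′) (sym (palⱼ t t′ mirror)))
    where
    t′ = L ∸ suc t
    mirror : suc (t + t′) ≡ L
    mirror = m+[n∸m]≡n t<L
    N≤t′ : N ≤ t′
    N≤t′ = +-cancelˡ-≤ N N t′ (≤-trans 2N≤L (≤-trans (≤-reflexive (sym mirror))
             (+-monoˡ-≤ t′ (≰⇒> N≰t))))

some-palindrome : {A : Set} (w : Word A) (n k : ℕ) →
  PalCount w n (suc k) → ∃ λ i → PalindromeAt w i n
some-palindrome w n k (u ∷ _ , _ , _ , _ , sound) with sound u (here refl)
... | (i , refl) , pal = i , palindrome⇒PalindromeAt w i n pal

two-palindromes : {A : Set} (w : Word A) (n : ℕ) → PalCount w n 2 →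
  Σ ℕ λ i → Σ ℕ λ j →
    PalindromeAt w i n × PalindromeAt w j n × factorAt w i n ≢ factorAt w j n
two-palindromes w n (u ∷ v ∷ [] , (u≢v ∷ []) ∷ _ , _ , _ , sound)
  with sound u (here refl) | sound v (there (here refl))
... | (i , refl) , palᵢ | (j , refl) , palⱼ =
  i , j , palindrome⇒PalindromeAt w i n palᵢ , palindrome⇒PalindromeAt w j n palⱼ , u≢v

-- Congruence modulo p = q + 1 (written with q so that p is visibly nonzero).
module Modulo (q : ℕ) where

  p : ℕ
  p = suc q

  infix 4 _≈_
  record _≈_ (a b : ℕ) : Set where
    constructor mod-eq
    field same-residue : a % p ≡ b % p

  ≈-isEquivalence : IsEquivalence _≈_
  ≈-isEquivalence = record
    { refl  = mod-eq refl
    ; sym   = λ (mod-eq e) → mod-eq (sym e)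
    ; trans = λ (mod-eq e) (mod-eq e′) → mod-eq (trans e e′)
    }

  ≈-setoid : Setoid 0ℓ 0ℓ
  ≈-setoid = record { isEquivalence = ≈-isEquivalence }

  open IsEquivalence ≈-isEquivalence public
    using () renaming (refl to ≈-refl; sym to ≈-sym; trans to ≈-trans)

  module ≈-Reasoning = SetoidReasoning ≈-setoid

  ≡⇒≈ : ∀ {a b} → a ≡ b → a ≈ b
  ≡⇒≈ e = mod-eq (cong (_% p) e)

  +-cong : ∀ {a b c d} → a ≈ b → c ≈ d → a + c ≈ b + d
  +-cong {a} {b} {c} {d} (mod-eq e) (mod-eq e′) = mod-eq (begin
    (a + c) % p             ≡⟨ %-distribˡ-+ a c p ⟩
    (a % p + c % p) % p     ≡⟨ cong₂ (λ x y → (x + y) % p) e e′ ⟩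
    (b % p + d % p) % p     ≡⟨ %-distribˡ-+ b d p ⟨
    (b + d) % p             ∎)
    where open ≡-Reasoning

  *-congˡ : ∀ k {a b} → a ≈ b → k * a ≈ k * b
  *-congˡ k {a} {b} (mod-eq e) = mod-eq (begin
    (k * a) % p             ≡⟨ %-distribˡ-* k a p ⟩
    (k % p * (a % p)) % p   ≡⟨ cong (λ x → (k % p * x) % p) e ⟩
    (k % p * (b % p)) % p   ≡⟨ %-distribˡ-* k b p ⟨
    (k * b) % p             ∎)
    where open ≡-Reasoning

  residue≈ : ∀ a → a % p ≈ a
  residue≈ a = mod-eq (m%n%n≡m%n a p)

  multiple≈ : ∀ a k → a + k * p ≈ a
  multiple≈ a k = mod-eq ([m+kn]%n≡m%n a k p)

  +-comm≈ : ∀ a b → a + b ≈ b + a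
  +-comm≈ a b = ≡⇒≈ (+-comm a b)

  -- Addition cancels: subtracting c is adding q * c, as c + q * c = c * p.
  +-cancelˡ : ∀ c {a b} → c + a ≈ c + b → a ≈ b
  +-cancelˡ c {a} {b} e = begin
    a                 ≈⟨ multiple≈ a c ⟨
    a + c * p         ≡⟨ shuffle a ⟩
    (c + a) + q * c   ≈⟨ +-cong e ≈-refl ⟩
    (c + b) + q * c   ≡⟨ shuffle b ⟨
    b + c * p         ≈⟨ multiple≈ b c ⟩
    b                 ∎
    where
    open ≈-Reasoning
    shuffle : ∀ x → x + c * p ≡ (c + x) + q * c
    shuffle x = identity x c q
      where
      identity : ∀ x c q → x + c * suc q ≡ (c + x) + q * c
      identity = solve-∀

  +-cancelʳ : ∀ c {a b} → a + c ≈ b + c → a ≈ b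
  +-cancelʳ c {a} {b} e = +-cancelˡ c (≈-trans (+-comm≈ c a) (≈-trans e (+-comm≈ b c)))

  reflection : ∀ i s t {a b} → i + s ≈ a → a + b ≈ i + i + (s + t) → i + t ≈ b
  reflection i s t {a} {b} i+s≈a a+b≈c = +-cancelˡ (i + s) (begin
    (i + s) + (i + t)   ≡⟨ identity i s t ⟩
    i + i + (s + t)     ≈⟨ a+b≈c ⟨
    a + b               ≈⟨ +-cong i+s≈a ≈-refl ⟨
    (i + s) + b         ∎)
    where
    open ≈-Reasoning
    identity : ∀ i s t → (i + s) + (i + t) ≡ i + i + (s + t)
    identity = solve-∀

  residue-in-window : ∀ i a → ∃ λ s → s < p × i + s ≈ a
  residue-in-window i a = s , m%n<n (a + q * i) p , (begin
    i + s             ≈⟨ +-cong (≈-refl {i}) (residue≈ (a + q * i)) ⟩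
    i + (a + q * i)   ≡⟨ identity i a q ⟩
    a + i * p         ≈⟨ multiple≈ a i ⟩
    a                 ∎)
    where
    open ≈-Reasoning
    s = (a + q * i) % p
    identity : ∀ i a q → i + (a + q * i) ≡ a + i * suc q
    identity = solve-∀

  -- For odd p, doubling is injective modulo p: its inverse is multiplication by k + 1.
  halve : ∀ k → q ≡ k + k → ∀ {a b} → a + a ≈ b + b → a ≈ b
  halve k refl {a} {b} e = begin
    a                   ≈⟨ multiple≈ a a ⟨
    a + a * p           ≡⟨ identity k a ⟨
    suc k * (a + a)     ≈⟨ *-congˡ (suc k) e ⟩
    suc k * (b + b)     ≡⟨ identity k b ⟩
    b + b * p           ≈⟨ multiple≈ b b ⟩
    b                   ∎
    where
    open ≈-Reasoning
    identity : ∀ k x → suc k * (x + x) ≡ x + x * suc (k + k)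
    identity = solve-∀

  parity-preserved : ∀ k → q ≡ suc (k + k) → ∀ {a b} → a ≈ b → a % 2 ≡ b % 2
  parity-preserved k refl {a} {b} (mod-eq e) = begin
    a % 2       ≡⟨ m∣n⇒o%n%m≡o%m 2 p a 2∣p ⟨
    a % p % 2   ≡⟨ cong (_% 2) e ⟩
    b % p % 2   ≡⟨ m∣n⇒o%n%m≡o%m 2 p b 2∣p ⟩
    b % 2       ∎
    where
    open ≡-Reasoning
    2∣p : 2 ∣ p
    2∣p = divides (suc k) (identity k)
      where
      identity : ∀ k → suc (suc (k + k)) ≡ suc k * 2
      identity = solve-∀

Period : {A : Set} → Word A → ℕ → Set
Period f d = ∀ j → f (j + d) ≡ f j

module PeriodicWord {A : Set} (f : Word A) (q : ℕ) (period : Period f (suc q)) where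
  open Modulo q

  period-iterated : ∀ r k → f (r + k * p) ≡ f r
  period-iterated r zero = cong f (+-identityʳ r)
  period-iterated r (suc k) =
    trans (cong f (identity r k p)) (trans (period (r + k * p)) (period-iterated r k))
    where
    identity : ∀ r k p → r + (p + k * p) ≡ r + k * p + p
    identity = solve-∀

  periodic-cong : ∀ {a b} → a ≈ b → f a ≡ f b
  periodic-cong {a} {b} (mod-eq e) = begin
    f a                           ≡⟨ cong f (m≡m%n+[m/n]*n a p) ⟩
    f (a % p + (a / p) * p)       ≡⟨ period-iterated (a % p) (a / p) ⟩
    f (a % p)                     ≡⟨ cong f e ⟩
    f (b % p)                     ≡⟨ period-iterated (b % p) (b / p) ⟨
    f (b % p + (b / p) * p)       ≡⟨ cong f (m≡m%n+[m/n]*n b p) ⟨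
    f b                           ∎
    where open ≡-Reasoning

  Symmetric : ℕ → Set
  Symmetric c = ∀ a b → a + b ≈ c → f a ≡ f b

  -- A palindrome of length L + 1 ≥ p at position i makes f symmetric about
  -- its centre: every residue class has a representative inside it.
  palindrome⇒symmetric : ∀ i L → q ≤ L → PalindromeAt f i (suc L) → Symmetric (i + i + L)
  palindrome⇒symmetric i L q≤L pal a b a+b≈c with residue-in-window i a
  ... | s , s<p , i+s≈a = begin
    f a         ≡⟨ periodic-cong (≈-sym i+s≈a) ⟩
    f (i + s)   ≡⟨ pal s t (cong suc s+t≡L) ⟩
    f (i + t)   ≡⟨ periodic-cong i+t≈b ⟩
    f b         ∎
    where
    open ≡-Reasoning
    t = L ∸ s
    s+t≡L : s + t ≡ L
    s+t≡L = m+[n∸m]≡n (≤-trans (≤-pred s<p) q≤L)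
    i+t≈b : i + t ≈ b
    i+t≈b = reflection i s t i+s≈a (≈-trans a+b≈c (≡⇒≈ (cong (i + i +_) (sym s+t≡L))))

  symmetries⇒period : ∀ c c′ d → Symmetric c → Symmetric c′ → c + d ≈ c′ → Period f d
  symmetries⇒period c c′ d sym-c sym-c′ c+d≈c′ j with residue-in-window j c
  ... | b , _ , j+b≈c = trans (sym (sym-c′ b (j + d) b+j+d≈c′)) (sym-c b j b+j≈c)
    where
    open ≈-Reasoning
    b+j≈c : b + j ≈ c
    b+j≈c = ≈-trans (+-comm≈ b j) j+b≈c
    b+j+d≈c′ : b + (j + d) ≈ c′
    b+j+d≈c′ = begin
      b + (j + d)   ≡⟨ identity b j d ⟩
      (j + b) + d   ≈⟨ +-cong j+b≈c ≈-refl ⟩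
      c + d         ≈⟨ c+d≈c′ ⟩
      c′            ∎
      where
      identity : ∀ b j d → b + (j + d) ≡ (j + b) + d
      identity = solve-∀

  centres-congruent : (∀ d → d < q → ¬ Period f (suc d)) →
    ∀ c c′ → Symmetric c → Symmetric c′ → c ≈ c′
  centres-congruent minimal c c′ sym-c sym-c′ with residue-in-window c c′
  ... | zero  , _       , c+0≈c′ = ≈-trans (≡⇒≈ (sym (+-identityʳ c))) c+0≈c′
  ... | suc d , d+1<p , c+d≈c′ =
    ⊥-elim (minimal d (≤-pred d+1<p) (symmetries⇒period c c′ (suc d) sym-c sym-c′ c+d≈c′))

odd-centre-parity : ∀ i q → (i + i + (q + suc q)) % 2 ≡ 1
odd-centre-parity i q = trans (cong (_% 2) (identity i q)) ([m+kn]%n≡m%n 1 (i + q) 2)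
  where
  identity : ∀ i q → i + i + (q + suc q) ≡ 1 + (i + q) * 2
  identity = solve-∀

even-centre-parity : ∀ i p → (i + i + (p + p)) % 2 ≡ 0
even-centre-parity i p = trans (cong (_% 2) (identity i p)) ([m+kn]%n≡m%n 0 (i + p) 2)
  where
  identity : ∀ i p → i + i + (p + p) ≡ 0 + (i + p) * 2
  identity = solve-∀

even-or-odd : ∀ n → ∃ λ k → n ≡ k + k ⊎ n ≡ suc (k + k)
even-or-odd zero = 0 , inj₁ refl
even-or-odd (suc n) with even-or-odd n
... | k , inj₁ refl = k , inj₂ refl
... | k , inj₂ refl = suc k , inj₁ (cong suc (sym (+-suc k k)))

module LeastPeriod {A : Set} (w : Word A)
  (even-counts : ∀ m → PalCount w (2 * m) 1)
  (odd-counts  : ∀ m → PalCount w (2 * m + 1) 2)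
  (N q : ℕ) (period : Period (suffix N w) (suc q))
  (minimal : ∀ d → d < q → ¬ Period (suffix N w) (suc d)) where
  open Modulo q
  open PeriodicWord (suffix N w) q period

  -- Palindromes of length 2K and 2K + 1 reach p letters beyond the prefix
  -- at both ends.
  K : ℕ
  K = N + p

  even-centre : ∀ i → PalindromeAt w i (2 * K) → Symmetric (i + i + (q + p))
  even-centre i pal = palindrome⇒symmetric i (q + p) (m≤m+n q p)
    (trim w N i (p + p) (2 * K) (length-eq N p) pal)
    where
    length-eq : ∀ N p → N + (p + p) + N ≡ 2 * (N + p)
    length-eq = solve-∀

  odd-centre : ∀ i → PalindromeAt w i (2 * K + 1) → Symmetric (i + i + (p + p))
  odd-centre i pal = palindrome⇒symmetric i (p + p) (≤-trans (n≤1+n q) (m≤m+n p p))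
    (trim w N i (suc (p + p)) (2 * K + 1) (length-eq N p) pal)
    where
    length-eq : ∀ N p → N + suc (p + p) + N ≡ 2 * (N + p) + 1
    length-eq = solve-∀

  -- p even: the even palindrome has an odd centre, an odd palindrome an even one.
  p-not-even : ∀ k → q ≡ suc (k + k) → ⊥
  p-not-even k q-odd with some-palindrome w (2 * K) 0 (even-counts K)
                        | two-palindromes w (2 * K + 1) (odd-counts K)
  ... | i , palᵢ | j , _ , palⱼ , _ , _ = 1+n≢0 (begin
    1                           ≡⟨ odd-centre-parity i q ⟨
    (i + i + (q + p)) % 2       ≡⟨ parity-preserved k q-odd centres≈ ⟩
    (j + j + (p + p)) % 2       ≡⟨ even-centre-parity j p ⟩
    0                           ∎)
    where
    open ≡-Reasoning
    centres≈ : i + i + (q + p) ≈ j + j + (p + p)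
    centres≈ = centres-congruent minimal _ _ (even-centre i palᵢ) (odd-centre j palⱼ)

  -- p odd: the two odd palindromes start at congruent positions, hence they
  -- agree beyond the prefix, hence everywhere.
  p-not-odd : ∀ k → q ≡ k + k → ⊥
  p-not-odd k q-even with two-palindromes w (2 * K + 1) (odd-counts K)
  ... | i₁ , i₂ , pal₁ , pal₂ , distinct =
    distinct (palindromes-equal w i₁ i₂ N (2 * K + 1) pal₁ pal₂ 2N≤length agree)
    where
    i₁≈i₂ : i₁ ≈ i₂
    i₁≈i₂ = halve k q-even (+-cancelʳ (p + p)
      (centres-congruent minimal _ _ (odd-centre i₁ pal₁) (odd-centre i₂ pal₂)))
    2N≤length : N + N ≤ 2 * K + 1
    2N≤length = ≤-trans (m≤m+n (N + N) (suc (p + p))) (≤-reflexive (identity N p))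
      where
      identity : ∀ N p → N + N + suc (p + p) ≡ 2 * (N + p) + 1
      identity = solve-∀
    agree : ∀ t → N ≤ t → w (i₁ + t) ≡ w (i₂ + t)
    agree t N≤t = begin
      w (i₁ + t)               ≡⟨ cong w (into-suffix i₁) ⟩
      w (N + (i₁ + (t ∸ N)))   ≡⟨ periodic-cong (+-cong i₁≈i₂ ≈-refl) ⟩
      w (N + (i₂ + (t ∸ N)))   ≡⟨ cong w (into-suffix i₂) ⟨
      w (i₂ + t)               ∎
      where
      open ≡-Reasoning
      into-suffix : ∀ i → i + t ≡ N + (i + (t ∸ N))
      into-suffix i = trans (cong (i +_) (sym (m+[n∸m]≡n N≤t))) (identity i N (t ∸ N))
        where
        identity : ∀ i N v → i + (N + v) ≡ N + (i + v)
        identity = solve-∀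

  contradiction : ⊥
  contradiction with even-or-odd q
  ... | k , inj₁ q-even = p-not-odd k q-even
  ... | k , inj₂ q-odd  = p-not-even k q-odd

no-period : {A : Set} (f : Word A) →
  (∀ q → Period f (suc q) → (∀ d → d < q → ¬ Period f (suc d)) → ⊥) →
  ∀ q → ¬ Period f (suc q)
no-period f refute-least = <-rec (λ q → ¬ Period f (suc q))
  λ q smaller period → refute-least q period (λ d d<q → smaller d<q)

uvω-after-prefix : {A : Set} (u : List A) (x : A) (xs : List A) (j : ℕ) →
  uvω u x xs (length u + j) ≡ uvω [] x xs j
uvω-after-prefix []       x xs j = refl
uvω-after-prefix (c ∷ cs) x xs j = uvω-after-prefix cs x xs j

vω-period : {A : Set} (x : A) (xs : List A) → Period (uvω [] x xs) (suc (length xs))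
vω-period x xs j =
  cong (lookup (x ∷ xs)) (fromℕ<-cong _ _ ([m+n]%n≡m%n j (suc (length xs))) _ _)

mainTheorem14 : {A : Set} (w : Word A)
    → (∀ m → PalCount w (2 * m) 1)
    → (∀ m → PalCount w (2 * m + 1) 2)
    → Aperiodic w
mainTheorem14 w even-counts odd-counts (u , x , xs , w≡uvω) =
  no-period (suffix (length u) w)
    (LeastPeriod.contradiction w even-counts odd-counts (length u))
    (length xs) suffix-period
  where
  open ≡-Reasoning
  suffix-is-vω : ∀ j → suffix (length u) w j ≡ uvω [] x xs j
  suffix-is-vω j = trans (w≡uvω (length u + j)) (uvω-after-prefix u x xs j)
  suffix-period : Period (suffix (length u) w) (suc (length xs))
  suffix-period j = begin
    suffix (length u) w (j + suc (length xs))   ≡⟨ suffix-is-vω _ ⟩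
    uvω [] x xs (j + suc (length xs))           ≡⟨ vω-period x xs j ⟩
    uvω [] x xs j                               ≡⟨ suffix-is-vω j ⟨
    suffix (length u) w j                       ∎
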